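{- Let $m \ge 4$ with $m \equiv 1 \pmod 3$, and let $n\ge 6$ with $n \equiv 0 \pmod 6$. Write $m = 3k+1$. Then $\gamma_{r2}(C_{m} \Box C_n) \leq kn + n$.
   Context: A 2-rainbow dominating function (2RDF) of a graph $G$ assigns to each vertex a subset of $\{1,2\}$ so that every vertex $v$ with $f(v)=\emptyset$ satisfies $\bigcup_{u\in N(v)} f(u)=\{1,2\}$; its weight is $\sum_v |f(v)|$ and $\gamma_{r2}(G)$ is the minimum weight of a 2RDF of $G$. $C_m \Box C_n$ is the Cartesian product of the cycles $C_m$ and $C_n$. -}

module Defs where

open import Data.Nat using (ℕ; _+_; _*_; _≤_; _%_; NonZero)
open import Data.Nat.Properties using ()
open import Data.Fin using (Fin; toℕ)
open import Data.Bool using (Bool; true; false)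
open import Data.Product using (_×_; _,_; ∃; ∃-syntax; Σ)
open import Data.List using (List; map; allFin)
open import Data.Nat.ListAction using (sum)
open import Data.List using (cartesianProduct)
open import Data.Sum using (_⊎_)
open import Relation.Binary.PropositionalEquality using (_≡_)

CycleAdj : (m : ℕ) .{{_ : NonZero m}} → Fin m → Fin m → Set
CycleAdj m i j = (toℕ j ≡ (toℕ i + 1) % m) ⊎ (toℕ i ≡ (toℕ j + 1) % m)

TorusAdj : (m n : ℕ) .{{_ : NonZero m}} .{{_ : NonZero n}} →
           Fin m × Fin n → Fin m × Fin n → Set
TorusAdj m n (i , j) (i' , j') =
  (i ≡ i' × CycleAdj n j j') ⊎ (j ≡ j' × CycleAdj m i i')

-- A subset of {1,2}, encoded by its characteristic pair (1 ∈ S , 2 ∈ S).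
Subset12 : Set
Subset12 = Bool × Bool

isEmpty : Subset12 → Set
isEmpty s = s ≡ (false , false)

has1 : Subset12 → Set
has1 (a , _) = a ≡ true

has2 : Subset12 → Set
has2 (_ , b) = b ≡ true

card : Subset12 → ℕ
card (false , false) = 0
card (true , false) = 1
card (false , true) = 1
card (true , true) = 2

Is2RDF : (m n : ℕ) .{{_ : NonZero m}} .{{_ : NonZero n}} →
         (Fin m × Fin n → Subset12) → Set
Is2RDF m n f = ∀ v → isEmpty (f v) →
  (∃[ u ] (TorusAdj m n v u × has1 (f u))) ×
  (∃[ u ] (TorusAdj m n v u × has2 (f u)))

weight : (m n : ℕ) → (Fin m × Fin n → Subset12) → ℕ
weight m n f = sum (map (λ v → card (f v)) (cartesianProduct (allFin m) (allFin n)))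

γr2≤ : (m n : ℕ) .{{_ : NonZero m}} .{{_ : NonZero n}} → ℕ → Set
γr2≤ m n b = ∃[ f ] (Is2RDF m n f × weight m n f ≤ b)

-- Row 0 alternates the colours {1} and {2} with the parity of the column; in row i + 1 the cell in
-- column j carries the colour of j's parity exactly when i + j ≡ 0 (mod 3). An empty cell (i + 1, j)
-- has i + j ≡ 1 or 2 (mod 3): in the first case its neighbours in row i and column j - 1, in the
-- second its neighbours in row i + 2 (row 0 after wrapping around) and column j + 1 are labelled,
-- with the colours of two adjacent columns, hence with both colours. Since 6 ∣ n, the residue mod 3
-- and the parity both continue across the seam of the column cycle. The weight is n for row 0 plus
-- n/3 for each of the other 3k rows.
module Submission where

open import Defs
open import Data.Nat using (ℕ; _+_; _*_; _≤_; _%_; NonZero)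
open import Relation.Binary.PropositionalEquality using (_≡_)

open import Data.Bool using (Bool; true; false; not)
open import Data.Empty using (⊥-elim)
open import Data.Fin using (Fin; zero; suc; toℕ; fromℕ; inject₁)
open import Data.Fin.Properties using (toℕ-fromℕ; toℕ-inject₁; toℕ<n)
open import Data.Fin.Relation.Unary.Top using (view; ‵fromℕ; ‵inject₁)
open import Data.List using (List; []; _∷_; _++_; map; allFin; tabulate; cartesianProduct)
open import Data.List.Properties using (map-++; map-∘; map-cong; map-tabulate)
open import Data.Nat using (zero; suc)
open import Data.Nat.Divisibility using (_∣_; divides; m%n≡0⇒n∣m)
open import Data.Nat.DivMod using (m<n⇒m%n≡m; n%n≡0)
open import Data.Nat.ListAction using (sum)
open import Data.Nat.ListAction.Properties using (sum-++)
open import Data.Nat.Properties using (+-comm; +-assoc; +-identityʳ; +-suc; suc-injective; 0≢1+n; ≤-reflexive)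
open import Data.Nat.Tactic.RingSolver using (solve)
open import Data.Product using (_×_; _,_; ∃-syntax; proj₁; proj₂)
open import Data.Sum using (_⊎_; inj₁; inj₂; swap)
import Data.Sum as Sum
open import Function using (_∘_; id)
open import Relation.Binary.PropositionalEquality using (refl; sym; trans; cong; cong₂; module ≡-Reasoning)
open import Relation.Nullary using (¬_)

open ≡-Reasoning

module _ {N : ℕ} .{{_ : NonZero N}} where

  CycleAdj-sym : {a b : Fin N} → CycleAdj N a b → CycleAdj N b a
  CycleAdj-sym = swap

  CycleAdj-suc : {a b : Fin N} → toℕ b ≡ suc (toℕ a) → CycleAdj N a b
  CycleAdj-suc {a} {b} b≡ rewrite +-comm (toℕ a) 1 | sym b≡ =
    inj₁ (sym (m<n⇒m%n≡m (toℕ<n b)))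

  CycleAdj-wrap : {a b : Fin N} → toℕ b ≡ 0 → suc (toℕ a) ≡ N → CycleAdj N a b
  CycleAdj-wrap {a} b≡0 a≡N rewrite +-comm (toℕ a) 1 | b≡0 | a≡N = inj₁ (sym (n%n≡0 N))

  cycle-succ : (a : Fin N) →
    ∃[ b ] (CycleAdj N a b × (toℕ b ≡ suc (toℕ a) ⊎ (toℕ b ≡ 0 × suc (toℕ a) ≡ N)))
  cycle-succ a with view a
  ... | ‵fromℕ = zero , CycleAdj-wrap refl last , inj₂ (refl , last)
    where last = cong suc (toℕ-fromℕ _)
  ... | ‵inject₁ i = suc i , CycleAdj-suc i+1 , inj₁ i+1
    where i+1 = cong suc (sym (toℕ-inject₁ i))

  cycle-pred : (a : Fin N) →
    ∃[ b ] (CycleAdj N a b × (suc (toℕ b) ≡ toℕ a ⊎ (toℕ a ≡ 0 × suc (toℕ b) ≡ N)))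
  cycle-pred zero = fromℕ _ , CycleAdj-sym (CycleAdj-wrap refl last) , inj₂ (refl , last)
    where last = cong suc (toℕ-fromℕ _)
  cycle-pred (suc i) = inject₁ i , CycleAdj-sym (CycleAdj-suc i+1) , inj₁ (sym i+1)
    where i+1 = cong suc (sym (toℕ-inject₁ i))

  cycle-pred-of-suc : ∀ {i} (a : Fin N) → toℕ a ≡ suc i → ∃[ b ] (CycleAdj N a b × toℕ b ≡ i)
  cycle-pred-of-suc a a≡ with cycle-pred a
  ... | b , a~b , inj₁ b+1≡a = b , a~b , suc-injective (trans b+1≡a a≡)
  ... | _ , _ , inj₂ (a≡0 , _) = ⊥-elim (0≢1+n (trans (sym a≡0) a≡))

  module _ {A : Set} (φ : ℕ → A) (φN≡φ0 : φ N ≡ φ 0) where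

    cycle-pred-periodic : (a : Fin N) → ∃[ b ] (CycleAdj N a b × φ (suc (toℕ b)) ≡ φ (toℕ a))
    cycle-pred-periodic a with cycle-pred a
    ... | b , a~b , inj₁ b+1≡a = b , a~b , cong φ b+1≡a
    ... | b , a~b , inj₂ (a≡0 , b+1≡N) =
      b , a~b , trans (cong φ b+1≡N) (trans φN≡φ0 (cong φ (sym a≡0)))

    cycle-succ-periodic : (a : Fin N) → ∃[ b ] (CycleAdj N a b × φ (toℕ b) ≡ φ (suc (toℕ a)))
    cycle-succ-periodic a with cycle-succ a
    ... | b , a~b , inj₁ b≡a+1 = b , a~b , cong φ b≡a+1
    ... | b , a~b , inj₂ (b≡0 , a+1≡N) =
      b , a~b , trans (cong φ b≡0) (trans (sym φN≡φ0) (cong φ (sym a+1≡N)))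

Periodic : {A : Set} → ℕ → (ℕ → A) → Set
Periodic p φ = ∀ j → φ (p + j) ≡ φ j

periodic-∣ : ∀ {A : Set} {p N} {φ : ℕ → A} → Periodic p φ → p ∣ N → φ N ≡ φ 0
periodic-∣ {p = p} {φ = φ} per (divides q refl) =
  trans (cong φ (sym (+-identityʳ (q * p)))) (shift q 0)
  where
  shift : ∀ q j → φ (q * p + j) ≡ φ j
  shift zero    j = refl
  shift (suc q) j = trans (cong φ (+-assoc p (q * p) j)) (trans (per (q * p + j)) (shift q j))

∑< : ℕ → (ℕ → ℕ) → ℕ
∑< zero    h = 0
∑< (suc n) h = h 0 + ∑< n (h ∘ suc)

syntax ∑< n (λ j → e) = ∑[ j < n ] e

∑-cong : ∀ n {h h′ : ℕ → ℕ} → (∀ j → h j ≡ h′ j) → ∑< n h ≡ ∑< n h′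
∑-cong zero    h≡h′ = refl
∑-cong (suc n) h≡h′ = cong₂ _+_ (h≡h′ 0) (∑-cong n (h≡h′ ∘ suc))

∑-const : ∀ n {h : ℕ → ℕ} {c} → (∀ j → h j ≡ c) → ∑< n h ≡ n * c
∑-const zero    h≡c = refl
∑-const (suc n) h≡c = cong₂ _+_ (h≡c 0) (∑-const n (h≡c ∘ suc))

∑-+ : ∀ a b (h : ℕ → ℕ) → ∑< (a + b) h ≡ ∑< a h + ∑[ j < b ] h (a + j)
∑-+ zero    b h = refl
∑-+ (suc a) b h = trans (cong (h 0 +_) (∑-+ a b (h ∘ suc))) (sym (+-assoc (h 0) _ _))

∑-periodic : ∀ {p} {h : ℕ → ℕ} → Periodic p h → ∀ q → ∑< (q * p) h ≡ q * ∑< p h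
∑-periodic         per zero    = refl
∑-periodic {p} {h} per (suc q) = begin
  ∑< (p + q * p) h                     ≡⟨ ∑-+ p (q * p) h ⟩
  ∑< p h + ∑[ j < q * p ] h (p + j)    ≡⟨ cong (∑< p h +_) (∑-cong (q * p) per) ⟩
  ∑< p h + ∑< (q * p) h                ≡⟨ cong (∑< p h +_) (∑-periodic per q) ⟩
  ∑< p h + q * ∑< p h                  ∎

sum-cartesianProduct : ∀ {A B : Set} (h : A × B → ℕ) (xs : List A) (ys : List B) →
  sum (map h (cartesianProduct xs ys)) ≡ sum (map (λ x → sum (map (λ y → h (x , y)) ys)) xs)
sum-cartesianProduct h []       ys = refl
sum-cartesianProduct h (x ∷ xs) ys = begin
  sum (map h (map (x ,_) ys ++ cartesianProduct xs ys))
    ≡⟨ cong sum (map-++ h (map (x ,_) ys) (cartesianProduct xs ys)) ⟩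
  sum (map h (map (x ,_) ys) ++ map h (cartesianProduct xs ys))
    ≡⟨ sum-++ (map h (map (x ,_) ys)) (map h (cartesianProduct xs ys)) ⟩
  sum (map h (map (x ,_) ys)) + sum (map h (cartesianProduct xs ys))
    ≡⟨ cong₂ _+_ (cong sum (sym (map-∘ ys))) (sum-cartesianProduct h xs ys) ⟩
  sum (map (λ y → h (x , y)) ys) + sum (map (λ x → sum (map (λ y → h (x , y)) ys)) xs) ∎

sum-tabulate-toℕ : ∀ N (φ : ℕ → ℕ) → sum (tabulate (φ ∘ toℕ {N})) ≡ ∑< N φ
sum-tabulate-toℕ zero    φ = refl
sum-tabulate-toℕ (suc N) φ = cong (φ 0 +_) (sum-tabulate-toℕ N (φ ∘ suc))

sum-allFin-toℕ : ∀ N (φ : ℕ → ℕ) → sum (map (φ ∘ toℕ) (allFin N)) ≡ ∑< N φ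
sum-allFin-toℕ N φ = trans (cong sum (map-tabulate {n = N} id (φ ∘ toℕ))) (sum-tabulate-toℕ N φ)

onTorus : ∀ {m n} → (ℕ → ℕ → Subset12) → Fin m × Fin n → Subset12
onTorus ψ (a , c) = ψ (toℕ a) (toℕ c)

weight-onTorus : ∀ m n (ψ : ℕ → ℕ → Subset12) →
  weight m n (onTorus ψ) ≡ ∑[ i < m ] ∑[ j < n ] card (ψ i j)
weight-onTorus m n ψ = begin
  weight m n (onTorus ψ)
    ≡⟨ sum-cartesianProduct (card ∘ onTorus ψ) (allFin m) (allFin n) ⟩
  sum (map (λ a → sum (map (λ c → card (ψ (toℕ a) (toℕ c))) (allFin n))) (allFin m))
    ≡⟨ cong sum (map-cong (λ a → sum-allFin-toℕ n (λ j → card (ψ (toℕ a) j))) (allFin m)) ⟩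
  sum (map (λ a → ∑[ j < n ] card (ψ (toℕ a) j)) (allFin m))
    ≡⟨ sum-allFin-toℕ m (λ i → ∑[ j < n ] card (ψ i j)) ⟩
  ∑[ i < m ] ∑[ j < n ] card (ψ i j) ∎

data Mod3 : Set where
  0₃ 1₃ 2₃ : Mod3

rot : Mod3 → Mod3
rot 0₃ = 1₃
rot 1₃ = 2₃
rot 2₃ = 0₃

rot≡1₃⇒0₃ : ∀ {r} → rot r ≡ 1₃ → r ≡ 0₃
rot≡1₃⇒0₃ {0₃} _ = refl

mod3 : ℕ → Mod3
mod3 zero    = 0₃
mod3 (suc n) = rot (mod3 n)

mod3-+-suc : ∀ j i → mod3 (j + suc i) ≡ rot (mod3 (j + i))
mod3-+-suc j i = cong mod3 (+-suc j i)

even : ℕ → Bool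
even zero    = true
even (suc n) = not (even n)

step : Mod3 × Bool → Mod3 × Bool
step (r , b) = rot r , not b

step⁶≡id : ∀ x → step (step (step (step (step (step x))))) ≡ x
step⁶≡id (0₃ , true)  = refl
step⁶≡id (0₃ , false) = refl
step⁶≡id (1₃ , true)  = refl
step⁶≡id (1₃ , false) = refl
step⁶≡id (2₃ , true)  = refl
step⁶≡id (2₃ , false) = refl

phase : ℕ → ℕ → Mod3 × Bool
phase i j = mod3 (j + i) , even j

phase-periodic : ∀ i → Periodic 6 (phase i)
phase-periodic i j = step⁶≡id (phase i j)

colour : Bool → Subset12
colour b = b , not b

colour-nonempty : ∀ {b} → ¬ isEmpty (colour b)
colour-nonempty {true}  ()
colour-nonempty {false} ()

card-colour : ∀ b → card (colour b) ≡ 1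
card-colour true  = refl
card-colour false = refl

diagonals : Mod3 × Bool → Subset12
diagonals (0₃ , b) = colour b
diagonals (1₃ , _) = false , false
diagonals (2₃ , _) = false , false

diagonals-before-1₃ : ∀ x {b} → step x ≡ (1₃ , b) → diagonals x ≡ colour (not b)
diagonals-before-1₃ (0₃ , true)  refl = refl
diagonals-before-1₃ (0₃ , false) refl = refl

label : ℕ → ℕ → Subset12
label zero    j = colour (even j)
label (suc i) j = diagonals (phase i j)

label-on-diagonal : ∀ i j → mod3 (j + i) ≡ 0₃ → label (suc i) j ≡ colour (even j)
label-on-diagonal i j r≡0 = cong (λ r → diagonals (r , even j)) r≡0

label-below-1₃ : ∀ i j → mod3 (j + i) ≡ 1₃ → label i j ≡ colour (even j)
label-below-1₃ zero    j _   = refl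
label-below-1₃ (suc i) j r≡1 =
  label-on-diagonal i j (rot≡1₃⇒0₃ (trans (sym (mod3-+-suc j i)) r≡1))

label-above-2₃ : ∀ {B i j} → mod3 (j + i) ≡ 2₃ → B ≡ suc (suc i) ⊎ B ≡ 0 →
  label B j ≡ colour (even j)
label-above-2₃ {i = i} {j} r≡2 (inj₁ refl) =
  label-on-diagonal (suc i) j (trans (mod3-+-suc j i) (cong rot r≡2))
label-above-2₃             r≡2 (inj₂ refl) = refl

empty-cell : ∀ I j → isEmpty (label I j) →
  ∃[ i ] (I ≡ suc i × (mod3 (j + i) ≡ 1₃ ⊎ mod3 (j + i) ≡ 2₃))
empty-cell zero    j e = ⊥-elim (colour-nonempty e)
empty-cell (suc i) j e with mod3 (j + i) in r≡
... | 0₃ = ⊥-elim (colour-nonempty e)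
... | 1₃ = i , refl , inj₁ r≡
... | 2₃ = i , refl , inj₂ r≡

module _ {m n : ℕ} .{{_ : NonZero m}} .{{_ : NonZero n}} where

  RainbowDominated : (Fin m × Fin n → Subset12) → Fin m × Fin n → Set
  RainbowDominated f v =
    (∃[ u ] (TorusAdj m n v u × has1 (f u))) × (∃[ u ] (TorusAdj m n v u × has2 (f u)))

  opposite-colours-dominate : ∀ {f v u w} b → TorusAdj m n v u → TorusAdj m n v w →
    f u ≡ colour b → f w ≡ colour (not b) → RainbowDominated f v
  opposite-colours-dominate {u = u} {w} true  v~u v~w fu≡ fw≡ =
    (u , v~u , cong proj₁ fu≡) , (w , v~w , cong proj₂ fw≡)
  opposite-colours-dominate {u = u} {w} false v~u v~w fu≡ fw≡ =
    (w , v~w , cong proj₁ fw≡) , (u , v~u , cong proj₂ fu≡)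

  module _ (6∣n : 6 ∣ n) where

    seam : ∀ i → phase i n ≡ phase i 0
    seam i = periodic-∣ (phase-periodic i) 6∣n

    dominated-1₃ : ∀ {a c i} → toℕ a ≡ suc i → mod3 (toℕ c + i) ≡ 1₃ →
      RainbowDominated (onTorus label) (a , c)
    dominated-1₃ {a} {c} {i} a≡ r≡1
      with cycle-pred-of-suc a a≡ | cycle-pred-periodic (phase i) (seam i) c
    ... | b , a~b , b≡ | c′ , c~c′ , c′≡ =
      opposite-colours-dominate (even (toℕ c)) (inj₂ (refl , a~b)) (inj₁ (refl , c~c′)) below left
      where
      below : label (toℕ b) (toℕ c) ≡ colour (even (toℕ c))
      below rewrite b≡ = label-below-1₃ i (toℕ c) r≡1
      left : label (toℕ a) (toℕ c′) ≡ colour (not (even (toℕ c)))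
      left rewrite a≡ =
        diagonals-before-1₃ (phase i (toℕ c′)) (trans c′≡ (cong (_, even (toℕ c)) r≡1))

    dominated-2₃ : ∀ {a c i} → toℕ a ≡ suc i → mod3 (toℕ c + i) ≡ 2₃ →
      RainbowDominated (onTorus label) (a , c)
    dominated-2₃ {a} {c} {i} a≡ r≡2 with cycle-succ a | cycle-succ-periodic (phase i) (seam i) c
    ... | b , a~b , b≡ | c′ , c~c′ , c′≡ =
      opposite-colours-dominate (even (toℕ c)) (inj₂ (refl , a~b)) (inj₁ (refl , c~c′)) above right
      where
      above : label (toℕ b) (toℕ c) ≡ colour (even (toℕ c))
      above = label-above-2₃ r≡2 (Sum.map (λ b≡a+1 → trans b≡a+1 (cong suc a≡)) proj₁ b≡)
      right : label (toℕ a) (toℕ c′) ≡ colour (not (even (toℕ c)))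
      right rewrite a≡ =
        cong diagonals (trans c′≡ (cong (λ r → rot r , not (even (toℕ c))) r≡2))

    label-is-2RDF : Is2RDF m n (onTorus label)
    label-is-2RDF (a , c) e with empty-cell (toℕ a) (toℕ c) e
    ... | _ , a≡ , inj₁ r≡1 = dominated-1₃ a≡ r≡1
    ... | _ , a≡ , inj₂ r≡2 = dominated-2₃ a≡ r≡2

diagonals-row-weight : ∀ i q → ∑[ j < q * 6 ] card (diagonals (phase i j)) ≡ q * 2
diagonals-row-weight i q = begin
  ∑[ j < q * 6 ] card (diagonals (phase i j))
    ≡⟨ ∑-periodic (cong (card ∘ diagonals) ∘ phase-periodic i) q ⟩
  q * ∑[ j < 6 ] card (diagonals (phase i j))
    ≡⟨ cong (q *_) six-columns ⟩
  q * 2 ∎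
  where
  six-columns : ∑[ j < 6 ] card (diagonals (phase i j)) ≡ 2
  six-columns with mod3 i
  ... | 0₃ = refl
  ... | 1₃ = refl
  ... | 2₃ = refl

label-weight : ∀ k n → 6 ∣ n → ∑[ i < suc (3 * k) ] ∑[ j < n ] card (label i j) ≡ k * n + n
label-weight k n (divides q refl) = begin
  ∑[ j < q * 6 ] card (colour (even j)) + ∑[ i < 3 * k ] ∑[ j < q * 6 ] card (diagonals (phase i j))
    ≡⟨ cong₂ _+_ (∑-const (q * 6) (card-colour ∘ even))
                 (∑-const (3 * k) (λ i → diagonals-row-weight i q)) ⟩
  q * 6 * 1 + 3 * k * (q * 2)
    ≡⟨ solve (k ∷ q ∷ []) ⟩
  k * (q * 6) + q * 6 ∎

proposition3 : (m n k : ℕ) .{{_ : NonZero m}} .{{_ : NonZero n}} →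
    4 ≤ m → m ≡ 3 * k + 1 → 6 ≤ n → n % 6 ≡ 0 →
    γr2≤ m n (k * n + n)
proposition3 m n k _ m≡ _ n%6≡0 = onTorus label , label-is-2RDF 6∣n , ≤-reflexive weight≡
  where
  6∣n : 6 ∣ n
  6∣n = m%n≡0⇒n∣m n 6 n%6≡0
  weight≡ : weight m n (onTorus label) ≡ k * n + n
  weight≡ = begin
    weight m n (onTorus label)
      ≡⟨ weight-onTorus m n label ⟩
    ∑[ i < m ] ∑[ j < n ] card (label i j)
      ≡⟨ cong (λ m → ∑[ i < m ] ∑[ j < n ] card (label i j)) (trans m≡ (+-comm (3 * k) 1)) ⟩
    ∑[ i < suc (3 * k) ] ∑[ j < n ] card (label i j)
      ≡⟨ label-weight k n 6∣n ⟩
    k * n + n ∎
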